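{- If a graph $H$ contains an obstruction, then it contains an induced undecomposable subgraph $H'$ that has an obstruction.
   Context: Graphs may have loops. An obstruction in $H$ is a set $O\subseteq V(H)$ that induces an edge between two distinct loopless vertices ($|O|=2$), or has $|O|=3$ and private neighbors (each $u\in O$ has a neighbor adjacent to no other vertex of $O$), or has $|O|=3$ and co-private neighbors (each pair of distinct $u,v\in O$ has a common neighbor not adjacent to the remaining vertex of $O$). A decomposition of $H$ is a partition $(A,B,C)$ of $V(H)$ (parts possibly empty) with $B$ a clique of looped vertices with all $A$–$B$ edges present, $C$ an independent set of loopless vertices with no $A$–$C$ edges, $A\neq\emptyset$, $B\cup C\neq\emptyset$; $H$ is undecomposable if it has no decomposition. -}

module Defs where

open import Data.Nat using (ℕ)
open import Data.Fin using (Fin)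
open import Data.Bool using (Bool; true)
open import Data.Product using (Σ; ∃; ∃-syntax; _×_; _,_)
open import Data.Sum using (_⊎_)
open import Relation.Nullary using (¬_)
open import Relation.Binary.PropositionalEquality using (_≡_; _≢_)
open import Function.Definitions using (Injective)

record Graph : Set where
  field
    n    : ℕ
    adj  : Fin n → Fin n → Bool
    sym  : ∀ u v → adj u v ≡ adj v u

open Graph public

V : Graph → Set
V H = Fin (n H)

E : (H : Graph) → V H → V H → Set
E H u v = adj H u v ≡ true

Looped : (H : Graph) → V H → Set
Looped H v = E H v v

Obstruction2 : (H : Graph) → V H → V H → Set
Obstruction2 H u v = u ≢ v × ¬ Looped H u × ¬ Looped H v × E H u v

Distinct3 : {A : Set} → A → A → A → Set
Distinct3 u v w = u ≢ v × u ≢ w × v ≢ w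

PrivateNbr : (H : Graph) → V H → V H → V H → Set
PrivateNbr H u v w = ∃[ x ] (E H u x × ¬ E H v x × ¬ E H w x)

CoPrivateNbr : (H : Graph) → V H → V H → V H → Set
CoPrivateNbr H u v w = ∃[ x ] (E H u x × E H v x × ¬ E H w x)

ObstructionPriv : (H : Graph) → V H → V H → V H → Set
ObstructionPriv H u v w =
  Distinct3 u v w × PrivateNbr H u v w × PrivateNbr H v u w × PrivateNbr H w u v

ObstructionCoPriv : (H : Graph) → V H → V H → V H → Set
ObstructionCoPriv H u v w =
  Distinct3 u v w × CoPrivateNbr H u v w × CoPrivateNbr H u w v × CoPrivateNbr H v w u

HasObstruction : Graph → Set
HasObstruction H =
  (∃[ u ] ∃[ v ] Obstruction2 H u v)
  ⊎ (∃[ u ] ∃[ v ] ∃[ w ] ObstructionPriv H u v w)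
  ⊎ (∃[ u ] ∃[ v ] ∃[ w ] ObstructionCoPriv H u v w)

data Part : Set where
  A B C : Part

record Decomposition (H : Graph) : Set where
  field
    p        : V H → Part
    B-clique : ∀ u v → p u ≡ B → p v ≡ B → E H u v   -- includes u ≡ v: looped
    AB-full  : ∀ u v → p u ≡ A → p v ≡ B → E H u v
    C-indep  : ∀ u v → p u ≡ C → p v ≡ C → ¬ E H u v -- includes u ≡ v: loopless
    AC-none  : ∀ u v → p u ≡ A → p v ≡ C → ¬ E H u v
    A-nonempty  : ∃[ u ] p u ≡ A
    BC-nonempty : ∃[ u ] (p u ≡ B ⊎ p u ≡ C)

Undecomposable : Graph → Set
Undecomposable H = ¬ Decomposition H

induced : (H : Graph) (m : ℕ) → (Fin m → V H) → Graph
induced H m f = record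
  { n = m
  ; adj = λ i j → adj H (f i) (f j)
  ; sym = λ i j → sym H (f i) (f j)
  }

{-# OPTIONS --safe #-}
module Submission where

-- In a decomposition, two vertices each having a neighbour the other lacks lie in the same
-- part, and such a distinguishing neighbour lies on the same side of A as they do; the two
-- loopless ends of an edge are both forced into A. So the vertices of an obstruction and its
-- witnessing neighbours lie all in A or all outside A. The subgraph induced on exactly these
-- vertices keeps the obstruction, and a decomposition of it would leave A or B ∪ C empty.

open import Defs hiding (sym)
open import Data.Nat using (ℕ)
open import Data.Fin using (Fin; zero; suc)
open import Data.Fin.Properties using (_≟_)
open import Data.Bool using (Bool; true; false)
open import Data.Product using (Σ; Σ-syntax; ∃-syntax; _×_; _,_; proj₁; proj₂)
open import Data.Sum using (inj₁; inj₂; [_,_])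
open import Data.Empty using (⊥-elim)
open import Data.List using (List; []; _∷_; map; length; lookup; deduplicate)
open import Data.List.Relation.Unary.All as All using (All; []; _∷_)
open import Data.List.Relation.Unary.Any using (index)
open import Data.List.Relation.Unary.Any.Properties using (lookup-index)
open import Data.List.Relation.Unary.Unique.Propositional using (Unique; _∷_)
open import Data.List.Relation.Unary.Unique.DecPropositional.Properties using (deduplicate-!)
open import Data.List.Membership.Propositional using (_∈_)
open import Data.List.Membership.Propositional.Properties
  using (∈-map⁻; ∈-lookup; ∈-deduplicate⁺; ∈-deduplicate⁻)
open import Relation.Nullary using (¬_)
open import Relation.Binary.Definitions using (DecidableEquality)
open import Relation.Binary.PropositionalEquality
  using (_≡_; _≢_; refl; sym; trans; cong; subst; module ≡-Reasoning)
open import Function using (_∘_)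
open import Function.Definitions using (Injective)

module _ {X : Set} where

  lookup-injective : {xs : List X} → Unique xs → Injective _≡_ _≡_ (lookup xs)
  lookup-injective {_ ∷ _}  (_ ∷ _)      {zero}  {zero}  _ = refl
  lookup-injective {_ ∷ _}  (x∉xs ∷ _)   {zero}  {suc j} e = ⊥-elim (All.lookup x∉xs (∈-lookup j) e)
  lookup-injective {_ ∷ _}  (x∉xs ∷ _)   {suc i} {zero}  e = ⊥-elim (All.lookup x∉xs (∈-lookup i) (sym e))
  lookup-injective {_ ∷ _}  (_ ∷ unique) {suc i} {suc j} e = cong suc (lookup-injective unique e)

  ∈-map-injective : {Y : Set} {f : X → Y} → Injective _≡_ _≡_ f →
                    ∀ {x xs} → f x ∈ map f xs → x ∈ xs
  ∈-map-injective f-injective fx∈ with ∈-map⁻ _ fx∈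
  ... | y , y∈xs , fx≡fy = subst (_∈ _) (sym (f-injective fx≡fy)) y∈xs

module Enumeration {X : Set} (_≟ˣ_ : DecidableEquality X) (xs : List X) where

  enumeration : Fin (length (deduplicate _≟ˣ_ xs)) → X
  enumeration = lookup (deduplicate _≟ˣ_ xs)

  enumeration-injective : Injective _≡_ _≡_ enumeration
  enumeration-injective = lookup-injective (deduplicate-! _≟ˣ_ xs)

  enumeration-⊆ : ∀ i → enumeration i ∈ xs
  enumeration-⊆ i = ∈-deduplicate⁻ _≟ˣ_ xs (∈-lookup i)

  enumeration-covers : ∀ {x} → x ∈ xs → ∃[ i ] enumeration i ≡ x
  enumeration-covers {x} x∈xs = index x∈dedup , sym (lookup-index x∈dedup)
    where
    x∈dedup : x ∈ deduplicate _≟ˣ_ xs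
    x∈dedup = ∈-deduplicate⁺ _≟ˣ_ x∈xs

E-sym : (G : Graph) {x y : V G} → E G x y → E G y x
E-sym G {x} {y} e = trans (Graph.sym G y x) e

Distinguishes : (G : Graph) → V G → V G → V G → Set
Distinguishes G x a b = E G a x × ¬ E G b x

true≢false : true ≢ false
true≢false ()

isA : Part → Bool
isA A = true
isA B = false
isA C = false

support : (H : Graph) → HasObstruction H → List (V H)
support _ (inj₁ (u , v , _)) = u ∷ v ∷ []
support _ (inj₂ (inj₁ (u , v , w , _ , (x , _) , (y , _) , (z , _)))) = u ∷ v ∷ w ∷ x ∷ y ∷ z ∷ []
support _ (inj₂ (inj₂ (u , v , w , _ , (x , _) , (y , _) , (z , _)))) = u ∷ v ∷ w ∷ x ∷ y ∷ z ∷ []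

module _ {G : Graph} (d : Decomposition G) where
  open Decomposition d

  B-looped : ∀ {x} → p x ≡ B → Looped G x
  B-looped {x} px = B-clique x x px px

  C-neighbour-in-B : ∀ {x y} → p x ≡ C → E G x y → p y ≡ B
  C-neighbour-in-B {x} {y} px exy with p y in py
  ... | A = ⊥-elim (AC-none y x py px (E-sym G exy))
  ... | B = refl
  ... | C = ⊥-elim (C-indep x y px py exy)

  B-non-neighbour-in-C : ∀ {x y} → p x ≡ B → ¬ E G x y → p y ≡ C
  B-non-neighbour-in-C {x} {y} px ¬exy with p y in py
  ... | A = ⊥-elim (¬exy (E-sym G (AB-full y x py px)))
  ... | B = ⊥-elim (¬exy (B-clique x y px py))
  ... | C = refl

  B-distinguished-from-B : ∀ {x a b} → Distinguishes G x a b → p b ≡ B → p a ≡ B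
  B-distinguished-from-B (eax , ¬ebx) pb =
    C-neighbour-in-B (B-non-neighbour-in-C pb ¬ebx) (E-sym G eax)

  C-distinguished-from-C : ∀ {x a b} → Distinguishes G x a b → p a ≡ C → p b ≡ C
  C-distinguished-from-C (eax , ¬ebx) pa =
    B-non-neighbour-in-C (C-neighbour-in-B pa eax) (¬ebx ∘ E-sym G)

  mutually-distinguished-same-part : ∀ {x y a b} →
    Distinguishes G x a b → Distinguishes G y b a → p a ≡ p b
  mutually-distinguished-same-part {a = a} {b} δ δ′ with p a in pa | p b in pb
  ... | A | A = refl
  ... | B | B = refl
  ... | C | C = refl
  ... | _ | B = trans (sym pa) (B-distinguished-from-B δ pb)
  ... | B | _ = trans (sym (B-distinguished-from-B δ′ pa)) pb
  ... | _ | C = trans (sym pa) (C-distinguished-from-C δ′ pb)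
  ... | C | _ = trans (sym (C-distinguished-from-C δ pa)) pb

  A-distinguisher-in-A : ∀ {x a b} → Distinguishes G x a b → p a ≡ A → p b ≡ A → p x ≡ A
  A-distinguisher-in-A {x} {a} {b} (eax , ¬ebx) pa pb with p x in px
  ... | A = refl
  ... | B = ⊥-elim (¬ebx (AB-full b x pb px))
  ... | C = ⊥-elim (AC-none a x pa px eax)

  distinguisher-side : ∀ {x a b q} → Distinguishes G x a b → p a ≡ q → p b ≡ q →
                       isA (p x) ≡ isA q
  distinguisher-side {q = A} δ pa pb = cong isA (A-distinguisher-in-A δ pa pb)
  distinguisher-side {q = B} (_ , ¬ebx) _ pb = cong isA (B-non-neighbour-in-C pb ¬ebx)
  distinguisher-side {q = C} (eax , _) pa _ = cong isA (C-neighbour-in-B pa eax)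

  loopless-edge-in-A : ∀ {u v} → ¬ Looped G u → ¬ Looped G v → E G u v → p u ≡ A
  loopless-edge-in-A {u} ¬lu ¬lv euv with p u in pu
  ... | A = refl
  ... | B = ⊥-elim (¬lu (B-looped pu))
  ... | C = ⊥-elim (¬lv (B-looped (C-neighbour-in-B pu euv)))

  both-sides-inhabited : (s : Bool) → ¬ (∀ x → isA (p x) ≡ s)
  both-sides-inhabited s one-sided with A-nonempty | BC-nonempty
  ... | a , pa | c , pc = true≢false (begin
      true        ≡⟨ cong isA (sym pa) ⟩
      isA (p a)   ≡⟨ one-sided a ⟩
      s           ≡⟨ sym (one-sided c) ⟩
      isA (p c)   ≡⟨ [ cong isA , cong isA ] pc ⟩
      false       ∎)
    where open ≡-Reasoning

  OneSided : List (V G) → Set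
  OneSided xs = ∃[ s ] All (λ x → isA (p x) ≡ s) xs

  support-one-sided : (o : HasObstruction G) → OneSided (support G o)
  support-one-sided (inj₁ (_ , _ , _ , ¬lu , ¬lv , uv)) =
    true , cong isA (loopless-edge-in-A ¬lu ¬lv uv)
         ∷ cong isA (loopless-edge-in-A ¬lv ¬lu (E-sym G uv)) ∷ []
  support-one-sided
    (inj₂ (inj₁ (u , v , w , _ , (_ , ux , ¬vx , ¬wx) , (_ , vy , ¬uy , _) , (_ , wz , ¬uz , _)))) =
    isA (p u) , refl ∷ cong isA (sym u~v) ∷ cong isA (sym u~w)
              ∷ distinguisher-side (ux , ¬vx) refl (sym u~v)
              ∷ distinguisher-side (vy , ¬uy) (sym u~v) refl
              ∷ distinguisher-side (wz , ¬uz) (sym u~w) refl ∷ []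
    where
    u~v : p u ≡ p v
    u~v = mutually-distinguished-same-part (ux , ¬vx) (vy , ¬uy)
    u~w : p u ≡ p w
    u~w = mutually-distinguished-same-part (ux , ¬wx) (wz , ¬uz)
  support-one-sided
    (inj₂ (inj₂ (u , v , w , _ , (_ , ux , _ , ¬wx) , (_ , uy , _ , ¬vy) , (_ , vz , wz , ¬uz)))) =
    isA (p u) , refl ∷ cong isA (sym u~v) ∷ cong isA (sym u~w)
              ∷ distinguisher-side (ux , ¬wx) refl (sym u~w)
              ∷ distinguisher-side (uy , ¬vy) refl (sym u~v)
              ∷ distinguisher-side (vz , ¬uz) (sym u~v) refl ∷ []
    where
    u~v : p u ≡ p v
    u~v = mutually-distinguished-same-part (uy , ¬vy) (vz , ¬uz)
    u~w : p u ≡ p w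
    u~w = mutually-distinguished-same-part (ux , ¬wx) (wz , ¬uz)

Distinct3-reflect : {X Y : Set} (f : X → Y) {i j k : X} →
                    Distinct3 (f i) (f j) (f k) → Distinct3 i j k
Distinct3-reflect f (fi≢fj , fi≢fk , fj≢fk) = fi≢fj ∘ cong f , fi≢fk ∘ cong f , fj≢fk ∘ cong f

lift-obstruction : (H : Graph) {m : ℕ} (f : Fin m → V H) (o : HasObstruction H) →
  All (λ x → ∃[ i ] f i ≡ x) (support H o) →
  Σ[ o′ ∈ HasObstruction (induced H m f) ] map f (support (induced H m f) o′) ≡ support H o
lift-obstruction H f (inj₁ (_ , _ , u≢v , loopless-edge)) ((i , refl) ∷ (j , refl) ∷ []) =
  inj₁ (i , j , u≢v ∘ cong f , loopless-edge) , refl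
lift-obstruction H f (inj₂ (inj₁ (_ , _ , _ , ds , (_ , x) , (_ , y) , (_ , z))))
  ((i , refl) ∷ (j , refl) ∷ (k , refl) ∷ (i′ , refl) ∷ (j′ , refl) ∷ (k′ , refl) ∷ []) =
  inj₂ (inj₁ (i , j , k , Distinct3-reflect f ds , (i′ , x) , (j′ , y) , (k′ , z))) , refl
lift-obstruction H f (inj₂ (inj₂ (_ , _ , _ , ds , (_ , x) , (_ , y) , (_ , z))))
  ((i , refl) ∷ (j , refl) ∷ (k , refl) ∷ (i′ , refl) ∷ (j′ , refl) ∷ (k′ , refl) ∷ []) =
  inj₂ (inj₂ (i , j , k , Distinct3-reflect f ds , (i′ , x) , (j′ , y) , (k′ , z))) , refl

lemma7p12 : (H : Graph) → HasObstruction H →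
    ∃[ m ] Σ (Fin m → V H) λ f →
      Injective _≡_ _≡_ f × Undecomposable (induced H m f) × HasObstruction (induced H m f)
lemma7p12 H o = m , enumeration , enumeration-injective , undecomposable , o′
  where
  open Enumeration _≟_ (support H o)
  m : ℕ
  m = length (deduplicate _≟_ (support H o))
  G : Graph
  G = induced H m enumeration
  lifted : Σ[ o′ ∈ HasObstruction G ] map enumeration (support G o′) ≡ support H o
  lifted = lift-obstruction H enumeration o (All.tabulate enumeration-covers)
  o′ : HasObstruction G
  o′ = proj₁ lifted
  support-complete : ∀ i → i ∈ support G o′
  support-complete i = ∈-map-injective enumeration-injective
    (subst (enumeration i ∈_) (sym (proj₂ lifted)) (enumeration-⊆ i))
  undecomposable : Undecomposable G
  undecomposable d with support-one-sided d o′
  ... | s , one-sided = both-sides-inhabited d s (λ i → All.lookup one-sided (support-complete i))
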